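{- Let $\mathcal{G}_n$ be the set of words over $\{0,1\}$ consisting of $n$ zeros and $n$ ones. Then $$\sum_{n\ge0}\sum_{w\in\mathcal{G}_n} t^{\mathrm{da}(w)}x^n=\frac{1}{\sqrt{1-4tx+4(t^2-1)x^2}}.$$
   Context: For $w=w_1w_2\cdots w_{2n}\in\mathcal{G}_n$, the degree of asymmetry is $\mathrm{da}(w)=|\{i\in\{1,\dots,n\}: w_i\neq w_{2n+1-i}\}|$. -}

module Defs where

open import Data.Bool using (Bool; true; false)
open import Data.Nat as ℕ using (ℕ; zero; suc; _∸_)
open import Data.Integer using (ℤ; +_; -[1+_]; _+_; _*_)
open import Data.List using (List; []; _∷_; filter; length; concatMap)
open import Data.Vec as Vec using (Vec; []; _∷_; take; reverse)

-- all binary words (vectors over Bool ≅ {0,1}, true = 1) of length m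
allWords : (m : ℕ) → List (Vec Bool m)
allWords zero = [] ∷ []
allWords (suc m) = concatMap (λ w → (false ∷ w) ∷ (true ∷ w) ∷ []) (allWords m)

ones : ∀ {m} → Vec Bool m → ℕ
ones [] = 0
ones (true ∷ w) = suc (ones w)
ones (false ∷ w) = ones w

𝒢 : (n : ℕ) → List (Vec Bool (n ℕ.+ n))
𝒢 n = filter (λ w → ones w ℕ.≟ n) (allWords (n ℕ.+ n))

mismatches : ∀ {m} → Vec Bool m → Vec Bool m → ℕ
mismatches [] [] = 0
mismatches (true ∷ u) (true ∷ v) = mismatches u v
mismatches (false ∷ u) (false ∷ v) = mismatches u v
mismatches (true ∷ u) (false ∷ v) = suc (mismatches u v)
mismatches (false ∷ u) (true ∷ v) = suc (mismatches u v)

-- degree of asymmetry: #{ i ∈ {1..n} : w_i ≠ w_{2n+1-i} }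
-- (the first n letters of w compared with the first n letters of reverse w)
da : (n : ℕ) → Vec Bool (n ℕ.+ n) → ℕ
da n w = mismatches (take n w) (take n (reverse w))

-- Formal power series in two variables x, t with integer coefficients:
-- S n k is the coefficient of x^n t^k.
Series : Set
Series = ℕ → ℕ → ℤ

sumTo : ℕ → (ℕ → ℤ) → ℤ
sumTo zero f = f 0
sumTo (suc n) f = sumTo n f + f (suc n)

_⊛_ : Series → Series → Series
(f ⊛ g) n k = sumTo n (λ i → sumTo k (λ j → f i j * g (n ∸ i) (k ∸ j)))

one : Series
one zero zero = + 1
one _ _ = + 0

-- P = 1 - 4 t x + 4 (t^2 - 1) x^2 = 1 - 4 x t + 4 x^2 t^2 - 4 x^2
P : Series
P 0 0 = + 1
P 1 1 = -[1+ 3 ]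
P 2 2 = + 4
P 2 0 = -[1+ 3 ]
P _ _ = + 0

F : Series
F n k = + length (filter (λ w → da n w ℕ.≟ k) (𝒢 n))

module Submission where

open import Defs
open import Data.Bool using (Bool; true; false)
open import Data.Nat as ℕ using (ℕ; zero; suc; _∸_; _≤_; z≤n; _≡ᵇ_)
import Data.Nat.Properties as ℕₚ
open import Data.Integer using (ℤ; +_; -[1+_]; 0ℤ; _+_; _*_; _-_)
import Data.Integer.Properties as ℤₚ
open ℤₚ using (*-zeroʳ; *-identityʳ; +-identityˡ; +-identityʳ; *-distribˡ-+; pos-+; i*j≡0⇒i≡0∨j≡0)
open import Data.Integer.Tactic.RingSolver using (solve-∀)
open import Data.List using (List; []; _∷_; filter; length; concatMap; _++_)
open import Data.Vec as Vec using (Vec; []; _∷_; _∷ʳ_; take; reverse)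
import Data.Vec.Properties as Vecₚ
open import Data.Product using (_×_; _,_)
open import Data.Sum using (inj₂)
open import Level using (0ℓ)
open import Relation.Binary.Bundles using (Setoid)
open import Relation.Binary.PropositionalEquality
import Relation.Binary.Reasoning.Setoid as SetoidReasoning
open import Algebra.Properties.CommutativeSemigroup ℤₚ.+-commutativeSemigroup
  using () renaming (interchange to +-interchange)

-- Cutting a word w ∈ 𝒢 n into halves u and v, da w is the number of
-- mismatches between u and reverse v; so F n is the generating polynomial of
-- pairs of words of length n with n ones altogether, counted by mismatches.
-- Reading a pair column by column, each column contributes a factor 1, y²
-- or 2yt, hence F n k is the coefficient of yⁿtᵏ in Qⁿ, Q = 1 + y² + 2yt.
-- Euler's identity y∂_y Q^(m+1) = (m+1) Q^m y∂_y Q gives the recurrence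
-- (m+2) F_(m+2) = 2(2m+3) t F_(m+1) - 4(m+1)(t² - 1) F_m, which is the
-- coefficientwise form of 2 P θF + (θP) F = 0 for θ = x∂_x. Therefore
-- θ(F² P) = F (2 P θF + (θP) F) = 0, so F² P is constant in x, and its
-- constant term is 1.

-- Bivariate formal power series

infix  4 _≐_
infixr 6 _⊕_
infixr 7 _⊙_

_≐_ : Series → Series → Set
f ≐ g = ∀ n k → f n k ≡ g n k

≐-setoid : Setoid 0ℓ 0ℓ
≐-setoid = record
  { Carrier       = Series
  ; _≈_           = _≐_
  ; isEquivalence = record
    { refl  = λ _ _ → refl
    ; sym   = λ p n k → sym (p n k)
    ; trans = λ p q n k → trans (p n k) (q n k)
    }
  }

module ≐-Reasoning = SetoidReasoning ≐-setoid

0ₛ : Series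
0ₛ _ _ = 0ℤ

_⊕_ : Series → Series → Series
(f ⊕ g) n k = f n k + g n k

_⊙_ : ℤ → Series → Series
(c ⊙ g) n k = c * g n k

θ : Series → Series
θ g n k = + n * g n k

-- ↑₁ g and ↑₂ g are g multiplied by the first, respectively the second, variable.
↑₁ ↑₂ : Series → Series
↑₁ g zero    k = 0ℤ
↑₁ g (suc n) k = g n k
↑₂ g n zero    = 0ℤ
↑₂ g n (suc k) = g n k

↑ : ℕ → ℕ → Series → Series
↑ zero    zero    g = g
↑ zero    (suc j) g = ↑₂ (↑ zero j g)
↑ (suc i) j       g = ↑₁ (↑ i j g)

⊕-cong : ∀ {f f′ g g′} → f ≐ f′ → g ≐ g′ → f ⊕ g ≐ f′ ⊕ g′
⊕-cong p q n k = cong₂ _+_ (p n k) (q n k)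

⊙-cong : ∀ c {g h} → g ≐ h → c ⊙ g ≐ c ⊙ h
⊙-cong c p n k = cong (c *_) (p n k)

↑₂-cong-row : ∀ {g h} n → (∀ k → g n k ≡ h n k) → ∀ k → ↑₂ g n k ≡ ↑₂ h n k
↑₂-cong-row n p zero    = refl
↑₂-cong-row n p (suc k) = p k

↑₁-cong : ∀ {g h} → g ≐ h → ↑₁ g ≐ ↑₁ h
↑₁-cong p zero    k = refl
↑₁-cong p (suc n) k = p n k

↑₂-cong : ∀ {g h} → g ≐ h → ↑₂ g ≐ ↑₂ h
↑₂-cong p n = ↑₂-cong-row n (p n)

↑-cong : ∀ i j {g h} → g ≐ h → ↑ i j g ≐ ↑ i j h
↑-cong zero    zero    p = p
↑-cong zero    (suc j) p = ↑₂-cong (↑-cong zero j p)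
↑-cong (suc i) j       p = ↑₁-cong (↑-cong i j p)

↑₂-⊙ : ∀ c g → ↑₂ (c ⊙ g) ≐ c ⊙ ↑₂ g
↑₂-⊙ c g n zero    = sym (*-zeroʳ c)
↑₂-⊙ c g n (suc k) = refl

↑₂-⊕ : ∀ f g → ↑₂ (f ⊕ g) ≐ ↑₂ f ⊕ ↑₂ g
↑₂-⊕ f g n zero    = refl
↑₂-⊕ f g n (suc k) = refl

θ-↑₂ : ∀ g → θ (↑₂ g) ≐ ↑₂ (θ g)
θ-↑₂ g n zero    = *-zeroʳ (+ n)
θ-↑₂ g n (suc k) = refl

sumTo-cong≤ : ∀ n {f g : ℕ → ℤ} → (∀ i → i ≤ n → f i ≡ g i) → sumTo n f ≡ sumTo n g
sumTo-cong≤ zero    p = p 0 z≤n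
sumTo-cong≤ (suc n) p =
  cong₂ _+_ (sumTo-cong≤ n (λ i i≤n → p i (ℕₚ.m≤n⇒m≤1+n i≤n))) (p (suc n) ℕₚ.≤-refl)

sumTo-cong : ∀ n {f g : ℕ → ℤ} → (∀ i → f i ≡ g i) → sumTo n f ≡ sumTo n g
sumTo-cong n p = sumTo-cong≤ n (λ i _ → p i)

sumTo-≡0 : ∀ n {f : ℕ → ℤ} → (∀ i → f i ≡ 0ℤ) → sumTo n f ≡ 0ℤ
sumTo-≡0 zero    p = p 0
sumTo-≡0 (suc n) p = cong₂ _+_ (sumTo-≡0 n p) (p (suc n))

sumTo-+ : ∀ n (f g : ℕ → ℤ) → sumTo n (λ i → f i + g i) ≡ sumTo n f + sumTo n g
sumTo-+ zero    f g = refl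
sumTo-+ (suc n) f g =
  trans (cong (_+ (f (suc n) + g (suc n))) (sumTo-+ n f g))
        (+-interchange (sumTo n f) (sumTo n g) (f (suc n)) (g (suc n)))

sumTo-* : ∀ n c (f : ℕ → ℤ) → sumTo n (λ i → c * f i) ≡ c * sumTo n f
sumTo-* zero    c f = refl
sumTo-* (suc n) c f =
  trans (cong (_+ c * f (suc n)) (sumTo-* n c f)) (sym (*-distribˡ-+ c (sumTo n f) (f (suc n))))

sumTo-head : ∀ n (f : ℕ → ℤ) → sumTo (suc n) f ≡ f 0 + sumTo n (λ i → f (suc i))
sumTo-head zero    f = refl
sumTo-head (suc n) f =
  trans (cong (_+ f (suc (suc n))) (sumTo-head n f)) (ℤₚ.+-assoc (f 0) _ _)

sumTo-reverse : ∀ n (f : ℕ → ℤ) → sumTo n f ≡ sumTo n (λ i → f (n ∸ i))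
sumTo-reverse zero    f = refl
sumTo-reverse (suc n) f = begin
  sumTo n f + f (suc n)                       ≡⟨ cong (_+ f (suc n)) (sumTo-reverse n f) ⟩
  sumTo n (λ i → f (n ∸ i)) + f (suc n)       ≡⟨ ℤₚ.+-comm _ (f (suc n)) ⟩
  f (suc n) + sumTo n (λ i → f (n ∸ i))       ≡⟨ sym (sumTo-head n (λ i → f (suc n ∸ i))) ⟩
  sumTo (suc n) (λ i → f (suc n ∸ i))         ∎
  where open ≡-Reasoning

sumTo-antidiagonal : ∀ n (h : ℕ → ℕ → ℤ) →
  sumTo (suc n) (λ i → h i (suc n ∸ i)) ≡ sumTo n (λ i → h i (suc (n ∸ i))) + h (suc n) 0
sumTo-antidiagonal n h =
  cong₂ _+_ (sumTo-cong≤ n (λ i i≤n → cong (h i) (ℕₚ.+-∸-assoc 1 i≤n)))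
            (cong (h (suc n)) (ℕₚ.n∸n≡0 n))

sumTo-antidiagonal-↑ : ∀ n (h : ℕ → ℕ → ℤ) → (∀ i → h i 0 ≡ 0ℤ) →
  sumTo (suc n) (λ i → h i (suc n ∸ i)) ≡ sumTo n (λ i → h i (suc (n ∸ i)))
sumTo-antidiagonal-↑ n h h0 =
  trans (sumTo-antidiagonal n h)
        (trans (cong (λ z → sumTo n (λ i → h i (suc (n ∸ i))) + z) (h0 (suc n))) (+-identityʳ _))

sumTo-antidiagonal-δ : ∀ n (h : ℕ → ℕ → ℤ) → (∀ i r → h i (suc r) ≡ 0ℤ) →
  sumTo n (λ i → h i (n ∸ i)) ≡ h n 0
sumTo-antidiagonal-δ zero    h h0 = refl
sumTo-antidiagonal-δ (suc n) h h0 =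
  trans (sumTo-antidiagonal n h)
        (trans (cong (_+ h (suc n) 0) (sumTo-≡0 n (λ i → h0 i (n ∸ i)))) (+-identityˡ _))

⊛-congˡ : ∀ f {g h} → g ≐ h → f ⊛ g ≐ f ⊛ h
⊛-congˡ f p n k = sumTo-cong n (λ i → sumTo-cong k (λ j → cong (f i j *_) (p (n ∸ i) (k ∸ j))))

⊛-congʳ : ∀ {f g} h → f ≐ g → f ⊛ h ≐ g ⊛ h
⊛-congʳ h p n k = sumTo-cong n (λ i → sumTo-cong k (λ j → cong (_* h (n ∸ i) (k ∸ j)) (p i j)))

⊛-comm : ∀ f g → f ⊛ g ≐ g ⊛ f
⊛-comm f g n k =
  trans (sumTo-reverse n _) (sumTo-cong≤ n (λ i i≤n →
  trans (sumTo-reverse k _) (sumTo-cong≤ k (λ j j≤k →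
  trans (cong₂ (λ a b → f (n ∸ i) (k ∸ j) * g a b) (ℕₚ.m∸[m∸n]≡n i≤n) (ℕₚ.m∸[m∸n]≡n j≤k))
        (ℤₚ.*-comm (f (n ∸ i) (k ∸ j)) (g i j))))))

⊛-⊕ : ∀ f g h → f ⊛ (g ⊕ h) ≐ f ⊛ g ⊕ f ⊛ h
⊛-⊕ f g h n k =
  trans (sumTo-cong n (λ i → trans (sumTo-cong k (λ j → *-distribˡ-+ (f i j) _ _)) (sumTo-+ k _ _)))
        (sumTo-+ n _ _)

⊛-⊙ : ∀ f c g → f ⊛ (c ⊙ g) ≐ c ⊙ (f ⊛ g)
⊛-⊙ f c g n k =
  trans (sumTo-cong n (λ i → trans (sumTo-cong k (λ j → swap (f i j) c (g (n ∸ i) (k ∸ j)))) (sumTo-* k c _)))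
        (sumTo-* n c _)
  where
  swap : ∀ a c b → a * (c * b) ≡ c * (a * b)
  swap = solve-∀

⊛-0ₛ : ∀ f → f ⊛ 0ₛ ≐ 0ₛ
⊛-0ₛ f n k = sumTo-≡0 n (λ i → sumTo-≡0 k (λ j → *-zeroʳ (f i j)))

⊛-one : ∀ f → f ⊛ one ≐ f
⊛-one f n k =
  trans (sumTo-antidiagonal-δ n (λ i r → sumTo k (λ j → f i j * one r (k ∸ j)))
                                (λ i r → sumTo-≡0 k (λ j → *-zeroʳ (f i j))))
  (trans (sumTo-antidiagonal-δ k (λ j r → f n j * one 0 r) (λ j r → *-zeroʳ (f n j)))
         (*-identityʳ (f n k)))

one-⊛ : ∀ f → one ⊛ f ≐ f
one-⊛ f n k = trans (⊛-comm one f n k) (⊛-one f n k)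

⊛-↑₁ : ∀ f g → f ⊛ ↑₁ g ≐ ↑₁ (f ⊛ g)
⊛-↑₁ f g zero    k = sumTo-≡0 k (λ j → *-zeroʳ (f 0 j))
⊛-↑₁ f g (suc n) k =
  sumTo-antidiagonal-↑ n (λ i r → sumTo k (λ j → f i j * ↑₁ g r (k ∸ j)))
                         (λ i → sumTo-≡0 k (λ j → *-zeroʳ (f i j)))

⊛-↑₂ : ∀ f g → f ⊛ ↑₂ g ≐ ↑₂ (f ⊛ g)
⊛-↑₂ f g n zero    = sumTo-≡0 n (λ i → *-zeroʳ (f i 0))
⊛-↑₂ f g n (suc k) =
  sumTo-cong n (λ i → sumTo-antidiagonal-↑ k (λ j r → f i j * ↑₂ g (n ∸ i) r) (λ j → *-zeroʳ (f i j)))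

⊛-↑ : ∀ i j f g → f ⊛ ↑ i j g ≐ ↑ i j (f ⊛ g)
⊛-↑ zero    zero    f g = λ _ _ → refl
⊛-↑ zero    (suc j) f g n k = trans (⊛-↑₂ f (↑ zero j g) n k) (↑₂-cong (⊛-↑ zero j f g) n k)
⊛-↑ (suc i) j       f g n k = trans (⊛-↑₁ f (↑ i j g) n k) (↑₁-cong (⊛-↑ i j f g) n k)

θ-⊛ : ∀ f g → θ (f ⊛ g) ≐ θ f ⊛ g ⊕ f ⊛ θ g
θ-⊛ f g n k =
  trans (sym (sumTo-* n (+ n) _)) (trans (sumTo-cong≤ n (λ i i≤n →
  trans (sym (sumTo-* k (+ n) _)) (trans (sumTo-cong k (λ j →
  trans (cong (_* (f i j * g (n ∸ i) (k ∸ j))) (split i≤n))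
        (leibniz (+ i) (+ (n ∸ i)) (f i j) (g (n ∸ i) (k ∸ j)))))
  (sumTo-+ k _ _)))) (sumTo-+ n _ _))
  where
  split : ∀ {i} → i ≤ n → + n ≡ + i + + (n ∸ i)
  split {i} i≤n = trans (cong +_ (sym (ℕₚ.m+[n∸m]≡n i≤n))) (pos-+ i (n ∸ i))
  leibniz : ∀ a b x y → (a + b) * (x * y) ≡ (a * x) * y + x * (b * y)
  leibniz = solve-∀

⊛-⊙ˡ : ∀ c f g → (c ⊙ f) ⊛ g ≐ c ⊙ (f ⊛ g)
⊛-⊙ˡ c f g n k =
  trans (⊛-comm (c ⊙ f) g n k) (trans (⊛-⊙ g c f n k) (cong (c *_) (⊛-comm g f n k)))

θ-cong : ∀ {g h} → g ≐ h → θ g ≐ θ h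
θ-cong p n k = cong (+ n *_) (p n k)

-- Multiplication by polynomials

-- A polynomial is a list of terms c x^i t^j, each written (c , i , j).
Polynomial : Set
Polynomial = List (ℤ × ℕ × ℕ)

infixr 7 _*ₚ_
_*ₚ_ : Polynomial → Series → Series
[]                *ₚ g = 0ₛ
((c , i , j) ∷ p) *ₚ g = c ⊙ ↑ i j g ⊕ p *ₚ g

⟦_⟧ : Polynomial → Series
⟦ p ⟧ = p *ₚ one

∂ : Polynomial → Polynomial
∂ []                = []
∂ ((c , i , j) ∷ p) = (+ i * c , i , j) ∷ ∂ p

*ₚ-cong : ∀ p {g h} → g ≐ h → p *ₚ g ≐ p *ₚ h
*ₚ-cong []                q = λ _ _ → refl
*ₚ-cong ((c , i , j) ∷ p) q = ⊕-cong (⊙-cong c (↑-cong i j q)) (*ₚ-cong p q)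

⊛-*ₚ : ∀ f p g → f ⊛ (p *ₚ g) ≐ p *ₚ (f ⊛ g)
⊛-*ₚ f []                g = ⊛-0ₛ f
⊛-*ₚ f ((c , i , j) ∷ p) g = begin
  f ⊛ (c ⊙ ↑ i j g ⊕ p *ₚ g)            ≈⟨ ⊛-⊕ f (c ⊙ ↑ i j g) (p *ₚ g) ⟩
  f ⊛ (c ⊙ ↑ i j g) ⊕ f ⊛ (p *ₚ g)      ≈⟨ ⊕-cong (⊛-⊙ f c (↑ i j g)) (⊛-*ₚ f p g) ⟩
  c ⊙ (f ⊛ ↑ i j g) ⊕ p *ₚ (f ⊛ g)      ≈⟨ ⊕-cong (⊙-cong c (⊛-↑ i j f g)) (λ _ _ → refl) ⟩
  c ⊙ ↑ i j (f ⊛ g) ⊕ p *ₚ (f ⊛ g)      ∎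
  where open ≐-Reasoning

⊛-⟦⟧ : ∀ f p → f ⊛ ⟦ p ⟧ ≐ p *ₚ f
⊛-⟦⟧ f p n k = trans (⊛-*ₚ f p one n k) (*ₚ-cong p (⊛-one f) n k)

⊛-assoc-⟦⟧ : ∀ f g p → (f ⊛ g) ⊛ ⟦ p ⟧ ≐ f ⊛ (g ⊛ ⟦ p ⟧)
⊛-assoc-⟦⟧ f g p = begin
  (f ⊛ g) ⊛ ⟦ p ⟧   ≈⟨ ⊛-⟦⟧ (f ⊛ g) p ⟩
  p *ₚ (f ⊛ g)      ≈⟨ ⊛-*ₚ f p g ⟨
  f ⊛ (p *ₚ g)      ≈⟨ ⊛-congˡ f (⊛-⟦⟧ g p) ⟨
  f ⊛ (g ⊛ ⟦ p ⟧)   ∎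
  where open ≐-Reasoning

*ₚ-↑₂ : ∀ p g → p *ₚ ↑₂ g ≐ ↑₂ (p *ₚ g)
*ₚ-↑₂ p g = begin
  p *ₚ ↑₂ g          ≈⟨ ⊛-⟦⟧ (↑₂ g) p ⟨
  ↑₂ g ⊛ ⟦ p ⟧       ≈⟨ ⊛-comm (↑₂ g) ⟦ p ⟧ ⟩
  ⟦ p ⟧ ⊛ ↑₂ g       ≈⟨ ⊛-↑₂ ⟦ p ⟧ g ⟩
  ↑₂ (⟦ p ⟧ ⊛ g)     ≈⟨ ↑₂-cong (⊛-comm ⟦ p ⟧ g) ⟩
  ↑₂ (g ⊛ ⟦ p ⟧)     ≈⟨ ↑₂-cong (⊛-⟦⟧ g p) ⟩
  ↑₂ (p *ₚ g)        ∎
  where open ≐-Reasoning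

↑-one-off-row : ∀ j n k → ↑ 0 j one (suc n) k ≡ 0ℤ
↑-one-off-row zero    n k       = refl
↑-one-off-row (suc j) n zero    = refl
↑-one-off-row (suc j) n (suc k) = ↑-one-off-row j n k

θ-monomial : ∀ i j → θ (↑ i j one) ≐ + i ⊙ ↑ i j one
θ-monomial zero    j zero    k = refl
θ-monomial zero    j (suc n) k =
  trans (cong (+ suc n *_) (↑-one-off-row j n k)) (*-zeroʳ (+ suc n))
θ-monomial (suc i) j zero    k = sym (*-zeroʳ (+ suc i))
θ-monomial (suc i) j (suc n) k = begin
  (+ 1 + + n) * x   ≡⟨ unfold (+ n) x ⟩
  x + + n * x       ≡⟨ cong (λ y → x + y) (θ-monomial i j n k) ⟩
  x + + i * x       ≡⟨ unfold (+ i) x ⟨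
  (+ 1 + + i) * x   ∎
  where
  open ≡-Reasoning
  x = ↑ i j one n k
  unfold : ∀ a x → (+ 1 + a) * x ≡ x + a * x
  unfold = solve-∀

θ-⟦⟧ : ∀ p → θ ⟦ p ⟧ ≐ ⟦ ∂ p ⟧
θ-⟦⟧ []                n k = *-zeroʳ (+ n)
θ-⟦⟧ ((c , i , j) ∷ p) n k = begin
  + n * (c * x + ⟦ p ⟧ n k)          ≡⟨ *-distribˡ-+ (+ n) _ _ ⟩
  + n * (c * x) + θ ⟦ p ⟧ n k        ≡⟨ cong₂ _+_ (reassoc (+ n) c x) (θ-⟦⟧ p n k) ⟩
  c * (+ n * x) + ⟦ ∂ p ⟧ n k        ≡⟨ cong (λ y → c * y + ⟦ ∂ p ⟧ n k) (θ-monomial i j n k) ⟩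
  c * (+ i * x) + ⟦ ∂ p ⟧ n k        ≡⟨ cong (_+ ⟦ ∂ p ⟧ n k) (reassoc c (+ i) x) ⟩
  + i * (c * x) + ⟦ ∂ p ⟧ n k        ≡⟨ cong (_+ ⟦ ∂ p ⟧ n k) (sym (ℤₚ.*-assoc (+ i) c x)) ⟩
  + i * c * x + ⟦ ∂ p ⟧ n k          ∎
  where
  open ≡-Reasoning
  x = ↑ i j one n k
  reassoc : ∀ a b x → a * (b * x) ≡ b * (a * x)
  reassoc = solve-∀

infixl 30 _^_
_^_ : Series → ℕ → Series
g ^ zero  = one
g ^ suc m = g ^ m ⊛ g

θ-^ : ∀ q m → θ (⟦ q ⟧ ^ suc m) ≐ + suc m ⊙ (⟦ q ⟧ ^ m ⊛ ⟦ ∂ q ⟧)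
θ-^ q zero = begin
  θ (one ⊛ ⟦ q ⟧)          ≈⟨ θ-cong (one-⊛ ⟦ q ⟧) ⟩
  θ ⟦ q ⟧                  ≈⟨ θ-⟦⟧ q ⟩
  ⟦ ∂ q ⟧                  ≈⟨ one-⊛ ⟦ ∂ q ⟧ ⟨
  one ⊛ ⟦ ∂ q ⟧            ≈⟨ (λ n k → ℤₚ.*-identityˡ ((one ⊛ ⟦ ∂ q ⟧) n k)) ⟨
  + 1 ⊙ (one ⊛ ⟦ ∂ q ⟧)    ∎
  where open ≐-Reasoning
θ-^ q (suc m) = begin
  θ (Q ^ suc m ⊛ Q)
    ≈⟨ θ-⊛ (Q ^ suc m) Q ⟩
  θ (Q ^ suc m) ⊛ Q ⊕ Q ^ suc m ⊛ θ Q
    ≈⟨ ⊕-cong (⊛-congʳ Q (θ-^ q m)) (⊛-congˡ (Q ^ suc m) (θ-⟦⟧ q)) ⟩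
  (+ suc m ⊙ (Q ^ m ⊛ Q′)) ⊛ Q ⊕ Q ^ suc m ⊛ Q′
    ≈⟨ ⊕-cong (⊛-⊙ˡ (+ suc m) (Q ^ m ⊛ Q′) Q) (λ _ _ → refl) ⟩
  + suc m ⊙ ((Q ^ m ⊛ Q′) ⊛ Q) ⊕ Q ^ suc m ⊛ Q′
    ≈⟨ ⊕-cong (⊙-cong (+ suc m) exchange) (λ _ _ → refl) ⟩
  + suc m ⊙ (Q ^ suc m ⊛ Q′) ⊕ Q ^ suc m ⊛ Q′
    ≈⟨ (λ n k → plus-one (+ suc m) ((Q ^ suc m ⊛ Q′) n k)) ⟩
  + suc (suc m) ⊙ (Q ^ suc m ⊛ Q′) ∎
  where
  open ≐-Reasoning
  Q Q′ : Series
  Q  = ⟦ q ⟧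
  Q′ = ⟦ ∂ q ⟧
  exchange : (Q ^ m ⊛ Q′) ⊛ Q ≐ Q ^ suc m ⊛ Q′
  exchange = begin
    (Q ^ m ⊛ Q′) ⊛ Q   ≈⟨ ⊛-assoc-⟦⟧ (Q ^ m) Q′ q ⟩
    Q ^ m ⊛ (Q′ ⊛ Q)   ≈⟨ ⊛-congˡ (Q ^ m) (⊛-comm Q′ Q) ⟩
    Q ^ m ⊛ (Q ⊛ Q′)   ≈⟨ ⊛-assoc-⟦⟧ (Q ^ m) Q (∂ q) ⟨
    Q ^ suc m ⊛ Q′     ∎
  plus-one : ∀ a x → a * x + x ≡ (+ 1 + a) * x
  plus-one = solve-∀

-- Counting words

𝟙 : Bool → ℤ
𝟙 true  = + 1
𝟙 false = 0ℤ

δ : ℕ → ℕ → Series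
δ a b n k = 𝟙 (a ≡ᵇ n) * 𝟙 (b ≡ᵇ k)

δ-↑ : ∀ i j a b → δ (i ℕ.+ a) (j ℕ.+ b) ≐ ↑ i j (δ a b)
δ-↑ zero    zero    a b = λ _ _ → refl
δ-↑ zero    (suc j) a b n zero    = *-zeroʳ (𝟙 (a ≡ᵇ n))
δ-↑ zero    (suc j) a b n (suc k) = δ-↑ zero j a b n k
δ-↑ (suc i) j       a b zero    k = refl
δ-↑ (suc i) j       a b (suc n) k = δ-↑ i j a b n k

sumList : {A : Set} → (A → ℤ) → List A → ℤ
sumList g []       = 0ℤ
sumList g (x ∷ xs) = g x + sumList g xs

sumList-++ : ∀ {A : Set} (g : A → ℤ) xs ys → sumList g (xs ++ ys) ≡ sumList g xs + sumList g ys
sumList-++ g []       ys = sym (+-identityˡ _)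
sumList-++ g (x ∷ xs) ys =
  trans (cong (λ y → g x + y) (sumList-++ g xs ys)) (sym (ℤₚ.+-assoc (g x) _ _))

sumList-concatMap : ∀ {A B : Set} (g : B → ℤ) (h : A → List B) xs →
  sumList g (concatMap h xs) ≡ sumList (λ x → sumList g (h x)) xs
sumList-concatMap g h []       = refl
sumList-concatMap g h (x ∷ xs) =
  trans (sumList-++ g (h x) _) (cong (λ y → sumList g (h x) + y) (sumList-concatMap g h xs))

sumList-filter : ∀ {A : Set} (f : A → ℕ) a (g : A → ℤ) xs →
  sumList g (filter (λ x → f x ℕ.≟ a) xs) ≡ sumList (λ x → 𝟙 (f x ≡ᵇ a) * g x) xs
sumList-filter f a g []       = refl
sumList-filter f a g (x ∷ xs) with f x ≡ᵇ a
... | true  = cong₂ _+_ (sym (ℤₚ.*-identityˡ (g x))) (sumList-filter f a g xs)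
... | false = trans (sumList-filter f a g xs) (sym (+-identityˡ _))

length-filter : ∀ {A : Set} (f : A → ℕ) a xs →
  + length (filter (λ x → f x ℕ.≟ a) xs) ≡ sumList (λ x → 𝟙 (f x ≡ᵇ a)) xs
length-filter f a []       = refl
length-filter f a (x ∷ xs) with f x ≡ᵇ a
... | true  = cong (λ y → + 1 + y) (length-filter f a xs)
... | false = trans (length-filter f a xs) (sym (+-identityˡ _))

Σw : (m : ℕ) → (Vec Bool m → ℤ) → ℤ
Σw zero    g = g []
Σw (suc m) g = Σw m (λ w → g (false ∷ w)) + Σw m (λ w → g (true ∷ w))

Σw-cong : ∀ m {g h : Vec Bool m → ℤ} → (∀ w → g w ≡ h w) → Σw m g ≡ Σw m h
Σw-cong zero    p = p []
Σw-cong (suc m) p = cong₂ _+_ (Σw-cong m (λ w → p (false ∷ w))) (Σw-cong m (λ w → p (true ∷ w)))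

Σw-≡0 : ∀ m {g : Vec Bool m → ℤ} → (∀ w → g w ≡ 0ℤ) → Σw m g ≡ 0ℤ
Σw-≡0 zero    p = p []
Σw-≡0 (suc m) p = cong₂ _+_ (Σw-≡0 m (λ w → p (false ∷ w))) (Σw-≡0 m (λ w → p (true ∷ w)))

Σw-+ : ∀ m (g h : Vec Bool m → ℤ) → Σw m (λ w → g w + h w) ≡ Σw m g + Σw m h
Σw-+ zero    g h = refl
Σw-+ (suc m) g h =
  trans (cong₂ _+_ (Σw-+ m g₀ h₀) (Σw-+ m g₁ h₁)) (+-interchange (Σw m g₀) (Σw m h₀) (Σw m g₁) (Σw m h₁))
  where
  g₀ g₁ h₀ h₁ : Vec Bool m → ℤ
  g₀ w = g (false ∷ w)
  g₁ w = g (true ∷ w)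
  h₀ w = h (false ∷ w)
  h₁ w = h (true ∷ w)

sumList-allWords : ∀ m (g : Vec Bool m → ℤ) → sumList g (allWords m) ≡ Σw m g
sumList-allWords zero    g = +-identityʳ (g [])
sumList-allWords (suc m) g = begin
  sumList g (allWords (suc m))
    ≡⟨ sumList-concatMap g _ (allWords m) ⟩
  sumList (λ w → g (false ∷ w) + (g (true ∷ w) + 0ℤ)) (allWords m)
    ≡⟨ sumList-cong (λ w → cong (λ y → g (false ∷ w) + y) (+-identityʳ (g (true ∷ w)))) (allWords m) ⟩
  sumList (λ w → g (false ∷ w) + g (true ∷ w)) (allWords m)
    ≡⟨ sumList-allWords m _ ⟩
  Σw m (λ w → g (false ∷ w) + g (true ∷ w))
    ≡⟨ Σw-+ m _ _ ⟩
  Σw (suc m) g ∎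
  where
  open ≡-Reasoning
  sumList-cong : ∀ {A : Set} {g h : A → ℤ} → (∀ x → g x ≡ h x) → ∀ xs → sumList g xs ≡ sumList h xs
  sumList-cong p []       = refl
  sumList-cong p (x ∷ xs) = cong₂ _+_ (p x) (sumList-cong p xs)

Σw-++ : ∀ a b (g : Vec Bool (a ℕ.+ b) → ℤ) → Σw (a ℕ.+ b) g ≡ Σw a (λ u → Σw b (λ v → g (u Vec.++ v)))
Σw-++ zero    b g = refl
Σw-++ (suc a) b g = cong₂ _+_ (Σw-++ a b (λ w → g (false ∷ w))) (Σw-++ a b (λ w → g (true ∷ w)))

Σw-∷ʳ : ∀ m (g : Vec Bool (suc m) → ℤ) →
  Σw (suc m) g ≡ Σw m (λ v → g (v ∷ʳ false)) + Σw m (λ v → g (v ∷ʳ true))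
Σw-∷ʳ zero    g = refl
Σw-∷ʳ (suc m) g =
  trans (cong₂ _+_ (Σw-∷ʳ m (λ w → g (false ∷ w))) (Σw-∷ʳ m (λ w → g (true ∷ w))))
        (+-interchange (Σw m (g₀ false)) (Σw m (g₀ true)) (Σw m (g₁ false)) (Σw m (g₁ true)))
  where
  g₀ g₁ : Bool → Vec Bool m → ℤ
  g₀ x v = g (false ∷ (v ∷ʳ x))
  g₁ x v = g (true ∷ (v ∷ʳ x))

Σw-reverse : ∀ m (g : Vec Bool m → ℤ) → Σw m (λ v → g (reverse v)) ≡ Σw m g
Σw-reverse zero    g = refl
Σw-reverse (suc m) g = begin
  Σw m (λ v → g (reverse (false ∷ v))) + Σw m (λ v → g (reverse (true ∷ v)))
    ≡⟨ cong₂ _+_ (Σw-cong m (λ v → cong g (Vecₚ.reverse-∷ false v)))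
                 (Σw-cong m (λ v → cong g (Vecₚ.reverse-∷ true v))) ⟩
  Σw m (λ v → g (reverse v ∷ʳ false)) + Σw m (λ v → g (reverse v ∷ʳ true))
    ≡⟨ cong₂ _+_ (Σw-reverse m (λ v → g (v ∷ʳ false))) (Σw-reverse m (λ v → g (v ∷ʳ true))) ⟩
  Σw m (λ v → g (v ∷ʳ false)) + Σw m (λ v → g (v ∷ʳ true))
    ≡⟨ Σw-∷ʳ m g ⟨
  Σw (suc m) g ∎
  where open ≡-Reasoning

Σₛ : (m : ℕ) → (Vec Bool m → Series) → Series
Σₛ m G n k = Σw m (λ w → G w n k)

Σₛ-cong : ∀ m {G H : Vec Bool m → Series} → (∀ w → G w ≐ H w) → Σₛ m G ≐ Σₛ m H
Σₛ-cong m p n k = Σw-cong m (λ w → p w n k)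

Σₛ-↑₁ : ∀ m (G : Vec Bool m → Series) → Σₛ m (λ w → ↑₁ (G w)) ≐ ↑₁ (Σₛ m G)
Σₛ-↑₁ m G zero    k = Σw-≡0 m (λ _ → refl)
Σₛ-↑₁ m G (suc n) k = refl

Σₛ-↑₂ : ∀ m (G : Vec Bool m → Series) → Σₛ m (λ w → ↑₂ (G w)) ≐ ↑₂ (Σₛ m G)
Σₛ-↑₂ m G n zero    = Σw-≡0 m (λ _ → refl)
Σₛ-↑₂ m G n (suc k) = refl

Σₛ-↑ : ∀ i j m (G : Vec Bool m → Series) → Σₛ m (λ w → ↑ i j (G w)) ≐ ↑ i j (Σₛ m G)
Σₛ-↑ zero    zero    m G = λ _ _ → refl
Σₛ-↑ zero    (suc j) m G n k =
  trans (Σₛ-↑₂ m (λ w → ↑ zero j (G w)) n k) (↑₂-cong (Σₛ-↑ zero j m G) n k)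
Σₛ-↑ (suc i) j       m G n k =
  trans (Σₛ-↑₁ m (λ w → ↑ i j (G w)) n k) (↑₁-cong (Σₛ-↑ i j m G) n k)

pairCount : ℕ → Series
pairCount m = Σₛ m λ u → Σₛ m λ v → δ (ones u ℕ.+ ones v) (mismatches u v)

Qpoly : Polynomial
Qpoly = (+ 1 , 0 , 0) ∷ (+ 1 , 2 , 0) ∷ (+ 2 , 1 , 1) ∷ []

pairCount-shift : ∀ m i j {a b : Vec Bool m → Vec Bool m → ℕ} →
  (∀ u v → a u v ≡ i ℕ.+ (ones u ℕ.+ ones v)) → (∀ u v → b u v ≡ j ℕ.+ mismatches u v) →
  (Σₛ m λ u → Σₛ m λ v → δ (a u v) (b u v)) ≐ ↑ i j (pairCount m)
pairCount-shift m i j {a} {b} pa pb = begin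
  (Σₛ m λ u → Σₛ m λ v → δ (a u v) (b u v))
    ≈⟨ Σₛ-cong m (λ u → Σₛ-cong m (λ v n k →
         trans (cong₂ (λ a b → δ a b n k) (pa u v) (pb u v)) (δ-↑ i j (ones u ℕ.+ ones v) (mismatches u v) n k))) ⟩
  (Σₛ m λ u → Σₛ m λ v → ↑ i j (δ (ones u ℕ.+ ones v) (mismatches u v)))
    ≈⟨ Σₛ-cong m (λ u → Σₛ-↑ i j m (λ v → δ (ones u ℕ.+ ones v) (mismatches u v))) ⟩
  (Σₛ m λ u → ↑ i j (Σₛ m λ v → δ (ones u ℕ.+ ones v) (mismatches u v)))
    ≈⟨ Σₛ-↑ i j m _ ⟩
  ↑ i j (pairCount m) ∎
  where open ≐-Reasoning

pairCount-suc : ∀ m → pairCount (suc m) ≐ Qpoly *ₚ pairCount m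
pairCount-suc m n k = begin
  Σw m (λ u → A u + B u) + Σw m (λ u → C u + D u)
    ≡⟨ cong₂ _+_ (Σw-+ m A B) (Σw-+ m C D) ⟩
  (pairCount m n k + Σw m B) + (Σw m C + Σw m D)
    ≡⟨ cong₂ (λ b c → (pairCount m n k + b) + (c + Σw m D))
             (pairCount-shift m 1 1 (λ u v → ℕₚ.+-suc (ones u) (ones v)) (λ _ _ → refl) n k)
             (pairCount-shift m 1 1 (λ _ _ → refl) (λ _ _ → refl) n k) ⟩
  (pairCount m n k + x) + (x + Σw m D)
    ≡⟨ cong (λ d → (pairCount m n k + x) + (x + d))
            (pairCount-shift m 2 0 (λ u v → cong suc (ℕₚ.+-suc (ones u) (ones v))) (λ _ _ → refl) n k) ⟩
  (pairCount m n k + x) + (x + ↑ 2 0 (pairCount m) n k)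
    ≡⟨ collect (pairCount m n k) x (↑ 2 0 (pairCount m) n k) ⟩
  (Qpoly *ₚ pairCount m) n k ∎
  where
  open ≡-Reasoning
  A B C D : Vec Bool m → ℤ
  A u = Σw m (λ v → δ (ones u ℕ.+ ones v) (mismatches u v) n k)
  B u = Σw m (λ v → δ (ones u ℕ.+ suc (ones v)) (suc (mismatches u v)) n k)
  C u = Σw m (λ v → δ (suc (ones u ℕ.+ ones v)) (suc (mismatches u v)) n k)
  D u = Σw m (λ v → δ (suc (ones u ℕ.+ suc (ones v))) (mismatches u v) n k)
  x = ↑ 1 1 (pairCount m) n k
  collect : ∀ a b c → (a + b) + (b + c) ≡ + 1 * a + (+ 1 * c + (+ 2 * b + 0ℤ))
  collect = solve-∀

pairCount-^ : ∀ m → pairCount m ≐ ⟦ Qpoly ⟧ ^ m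
pairCount-^ zero    zero    zero    = refl
pairCount-^ zero    zero    (suc k) = refl
pairCount-^ zero    (suc n) k       = refl
pairCount-^ (suc m) = begin
  pairCount (suc m)          ≈⟨ pairCount-suc m ⟩
  Qpoly *ₚ pairCount m        ≈⟨ *ₚ-cong Qpoly (pairCount-^ m) ⟩
  Qpoly *ₚ ⟦ Qpoly ⟧ ^ m      ≈⟨ ⊛-⟦⟧ (⟦ Qpoly ⟧ ^ m) Qpoly ⟨
  ⟦ Qpoly ⟧ ^ suc m           ∎
  where open ≐-Reasoning

take-++ : ∀ {A : Set} m {n} (u : Vec A m) (v : Vec A n) → take m (u Vec.++ v) ≡ u
take-++ zero    []      v = refl
take-++ (suc m) (x ∷ u) v = cong (x ∷_) (take-++ m u v)

ones-++ : ∀ {a b} (u : Vec Bool a) (v : Vec Bool b) → ones (u Vec.++ v) ≡ ones u ℕ.+ ones v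
ones-++ []          v = refl
ones-++ (true ∷ u)  v = cong suc (ones-++ u v)
ones-++ (false ∷ u) v = ones-++ u v

ones-∷ʳ : ∀ {m} (u : Vec Bool m) x → ones (u ∷ʳ x) ≡ ones (x ∷ u)
ones-∷ʳ []          x     = refl
ones-∷ʳ (true ∷ u)  true  = cong suc (ones-∷ʳ u true)
ones-∷ʳ (true ∷ u)  false = cong suc (ones-∷ʳ u false)
ones-∷ʳ (false ∷ u) true  = ones-∷ʳ u true
ones-∷ʳ (false ∷ u) false = ones-∷ʳ u false

ones-reverse : ∀ {m} (u : Vec Bool m) → ones (reverse u) ≡ ones u
ones-reverse []      = refl
ones-reverse {suc m} (x ∷ u) = begin
  ones (reverse (x ∷ u))   ≡⟨ cong ones (Vecₚ.reverse-∷ x u) ⟩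
  ones (reverse u ∷ʳ x)    ≡⟨ ones-∷ʳ (reverse u) x ⟩
  ones (x ∷ reverse u)     ≡⟨ ones-∷ x (ones-reverse u) ⟩
  ones (x ∷ u)             ∎
  where
  open ≡-Reasoning
  ones-∷ : ∀ x {v w : Vec Bool m} → ones v ≡ ones w → ones (x ∷ v) ≡ ones (x ∷ w)
  ones-∷ true  p = cong suc p
  ones-∷ false p = p

da-++ : ∀ n (u v : Vec Bool n) → da n (u Vec.++ v) ≡ mismatches u (reverse v)
da-++ n u v = cong₂ mismatches (take-++ n u v) (begin
  take n (reverse (u Vec.++ v))           ≡⟨ cong (take n) reverse-++ ⟩
  take n (reverse v Vec.++ reverse u)     ≡⟨ take-++ n (reverse v) (reverse u) ⟩
  reverse v                               ∎)
  where
  open ≡-Reasoning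
  reverse-++ : reverse (u Vec.++ v) ≡ reverse v Vec.++ reverse u
  reverse-++ = trans (sym (Vecₚ.cast-is-id refl _)) (Vecₚ.reverse-++-eqFree u v)

F≡pairCount : ∀ n k → F n k ≡ pairCount n n k
F≡pairCount n k = begin
  F n k
    ≡⟨ length-filter (da n) k (𝒢 n) ⟩
  sumList (λ w → 𝟙 (da n w ≡ᵇ k)) (𝒢 n)
    ≡⟨ sumList-filter ones n _ (allWords (n ℕ.+ n)) ⟩
  sumList (λ w → δ (ones w) (da n w) n k) (allWords (n ℕ.+ n))
    ≡⟨ sumList-allWords (n ℕ.+ n) _ ⟩
  Σw (n ℕ.+ n) (λ w → δ (ones w) (da n w) n k)
    ≡⟨ Σw-++ n n _ ⟩
  Σw n (λ u → Σw n (λ v → δ (ones (u Vec.++ v)) (da n (u Vec.++ v)) n k))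
    ≡⟨ Σw-cong n (λ u → Σw-cong n (λ v → cong₂ (λ a b → δ a b n k)
         (trans (ones-++ u v) (cong (ones u ℕ.+_) (sym (ones-reverse v)))) (da-++ n u v))) ⟩
  Σw n (λ u → Σw n (λ v → δ (ones u ℕ.+ ones (reverse v)) (mismatches u (reverse v)) n k))
    ≡⟨ Σw-cong n (λ u → Σw-reverse n (λ v → δ (ones u ℕ.+ ones v) (mismatches u v) n k)) ⟩
  pairCount n n k ∎
  where open ≡-Reasoning

-- The coefficient recurrence

F≡Q^ : ∀ n k → F n k ≡ (⟦ Qpoly ⟧ ^ n) n k
F≡Q^ n k = trans (F≡pairCount n k) (pairCount-^ n n k)

Q^-euler : ∀ m → θ (⟦ Qpoly ⟧ ^ suc m) ≐ + suc m ⊙ (∂ Qpoly *ₚ ⟦ Qpoly ⟧ ^ m)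
Q^-euler m n k = trans (θ-^ Qpoly m n k) (cong (+ suc m *_) (⊛-⟦⟧ (⟦ Qpoly ⟧ ^ m) (∂ Qpoly) n k))

Q^-euler-↑₂ : ∀ m → θ (↑₂ (⟦ Qpoly ⟧ ^ suc m)) ≐ + suc m ⊙ (∂ Qpoly *ₚ ↑₂ (⟦ Qpoly ⟧ ^ m))
Q^-euler-↑₂ m = begin
  θ (↑₂ (Q ^ suc m))                   ≈⟨ θ-↑₂ (Q ^ suc m) ⟩
  ↑₂ (θ (Q ^ suc m))                   ≈⟨ ↑₂-cong (Q^-euler m) ⟩
  ↑₂ (+ suc m ⊙ (∂ Qpoly *ₚ Q ^ m))    ≈⟨ ↑₂-⊙ (+ suc m) (∂ Qpoly *ₚ Q ^ m) ⟩
  + suc m ⊙ ↑₂ (∂ Qpoly *ₚ Q ^ m)      ≈⟨ ⊙-cong (+ suc m) (*ₚ-↑₂ (∂ Qpoly) (Q ^ m)) ⟨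
  + suc m ⊙ (∂ Qpoly *ₚ ↑₂ (Q ^ m))    ∎
  where
  open ≐-Reasoning
  Q = ⟦ Qpoly ⟧

-- The key step is (m+2) g = 2(m+1) g - m g, which eliminates the coefficient
-- g of yᵐtᵏ in Q^(m+1) using Q^(m+1) = Q^m Q and Euler's identity at (m , k).
diagonal-algebra : ∀ m c₂ c₁ c₀ c₀′ g x y z w →
  (+ 2 + m) * c₂ ≡ (+ 2 + m) * (+ 0 * z + (+ 2 * g + (+ 2 * c₁ + 0ℤ))) →
  m * g ≡ (+ 1 + m) * (+ 0 * c₀ + (+ 2 * y + (+ 2 * x + 0ℤ))) →
  g ≡ + 1 * c₀ + (+ 1 * y + (+ 2 * x + 0ℤ)) →
  (+ 1 + m) * c₁ ≡ (+ 1 + m) * (+ 0 * w + (+ 2 * x + (+ 2 * c₀′ + 0ℤ))) →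
  (+ 2 + m) * c₂ + + 4 * (+ 1 + m) * c₀′ ≡ + 2 * (+ 3 + + 2 * m) * c₁ + + 4 * (+ 1 + m) * c₀
diagonal-algebra m c₂ c₁ c₀ c₀′ g x y z w h₁ h₂ h₃ h₄ = begin
  (+ 2 + m) * c₂ + + 4 * (+ 1 + m) * c₀′
    ≡⟨ cong (_+ + 4 * (+ 1 + m) * c₀′) h₁ ⟩
  (+ 2 + m) * (+ 0 * z + (+ 2 * g + (+ 2 * c₁ + 0ℤ))) + + 4 * (+ 1 + m) * c₀′
    ≡⟨ step₁ m c₁ c₀′ g z ⟩
  + 2 * (+ 2 + m) * c₁ + (+ 4 * (+ 1 + m) * g - + 2 * (m * g)) + + 4 * (+ 1 + m) * c₀′
    ≡⟨ cong₂ (λ a b → + 2 * (+ 2 + m) * c₁ + (+ 4 * (+ 1 + m) * a - + 2 * b) + + 4 * (+ 1 + m) * c₀′) h₃ h₂ ⟩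
  + 2 * (+ 2 + m) * c₁
    + (+ 4 * (+ 1 + m) * (+ 1 * c₀ + (+ 1 * y + (+ 2 * x + 0ℤ)))
       - + 2 * ((+ 1 + m) * (+ 0 * c₀ + (+ 2 * y + (+ 2 * x + 0ℤ)))))
    + + 4 * (+ 1 + m) * c₀′
    ≡⟨ step₂ m c₁ c₀ c₀′ x y w ⟩
  + 2 * (+ 2 + m) * c₁ + + 2 * ((+ 1 + m) * (+ 0 * w + (+ 2 * x + (+ 2 * c₀′ + 0ℤ)))) + + 4 * (+ 1 + m) * c₀
    ≡⟨ cong (λ a → + 2 * (+ 2 + m) * c₁ + + 2 * a + + 4 * (+ 1 + m) * c₀) h₄ ⟨
  + 2 * (+ 2 + m) * c₁ + + 2 * ((+ 1 + m) * c₁) + + 4 * (+ 1 + m) * c₀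
    ≡⟨ step₃ m c₁ c₀ ⟩
  + 2 * (+ 3 + + 2 * m) * c₁ + + 4 * (+ 1 + m) * c₀ ∎
  where
  open ≡-Reasoning
  step₁ : ∀ m c₁ c₀′ g z →
    (+ 2 + m) * (+ 0 * z + (+ 2 * g + (+ 2 * c₁ + 0ℤ))) + + 4 * (+ 1 + m) * c₀′
    ≡ + 2 * (+ 2 + m) * c₁ + (+ 4 * (+ 1 + m) * g - + 2 * (m * g)) + + 4 * (+ 1 + m) * c₀′
  step₁ = solve-∀
  step₂ : ∀ m c₁ c₀ c₀′ x y w →
    + 2 * (+ 2 + m) * c₁
      + (+ 4 * (+ 1 + m) * (+ 1 * c₀ + (+ 1 * y + (+ 2 * x + 0ℤ)))
         - + 2 * ((+ 1 + m) * (+ 0 * c₀ + (+ 2 * y + (+ 2 * x + 0ℤ)))))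
      + + 4 * (+ 1 + m) * c₀′
    ≡ + 2 * (+ 2 + m) * c₁ + + 2 * ((+ 1 + m) * (+ 0 * w + (+ 2 * x + (+ 2 * c₀′ + 0ℤ)))) + + 4 * (+ 1 + m) * c₀
  step₂ = solve-∀
  step₃ : ∀ m c₁ c₀ →
    + 2 * (+ 2 + m) * c₁ + + 2 * ((+ 1 + m) * c₁) + + 4 * (+ 1 + m) * c₀
    ≡ + 2 * (+ 3 + + 2 * m) * c₁ + + 4 * (+ 1 + m) * c₀
  step₃ = solve-∀

Q^-diagonal-recurrence : ∀ m k →
  (+ 2 + + m) * (⟦ Qpoly ⟧ ^ (2 ℕ.+ m)) (2 ℕ.+ m) k + + 4 * (+ 1 + + m) * ↑₂ (↑₂ (⟦ Qpoly ⟧ ^ m)) m k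
  ≡ + 2 * (+ 3 + + 2 * + m) * ↑₂ (⟦ Qpoly ⟧ ^ (1 ℕ.+ m)) (1 ℕ.+ m) k + + 4 * (+ 1 + + m) * (⟦ Qpoly ⟧ ^ m) m k
Q^-diagonal-recurrence m k =
  diagonal-algebra (+ m)
    ((Q ^ (2 ℕ.+ m)) (2 ℕ.+ m) k) (↑₂ (Q ^ (1 ℕ.+ m)) (1 ℕ.+ m) k) ((Q ^ m) m k) (↑₂ (↑₂ (Q ^ m)) m k)
    ((Q ^ (1 ℕ.+ m)) m k) (↑₁ (↑₂ (Q ^ m)) m k) (↑₁ (↑₁ (Q ^ m)) m k)
    ((Q ^ (1 ℕ.+ m)) (2 ℕ.+ m) k) (↑₂ (Q ^ m) (1 ℕ.+ m) k)
    (Q^-euler (suc m) (2 ℕ.+ m) k)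
    (Q^-euler m m k)
    (⊛-⟦⟧ (Q ^ m) Qpoly m k)
    (Q^-euler-↑₂ m (1 ℕ.+ m) k)
  where
  Q = ⟦ Qpoly ⟧

F-recurrence : ∀ m k →
  (+ 2 + + m) * F (2 ℕ.+ m) k + + 4 * (+ 1 + + m) * ↑₂ (↑₂ F) m k
  ≡ + 2 * (+ 3 + + 2 * + m) * ↑₂ F (1 ℕ.+ m) k + + 4 * (+ 1 + + m) * F m k
F-recurrence m k =
  subst₂ (λ l r → l ≡ r)
    (cong₂ (λ a b → (+ 2 + + m) * a + + 4 * (+ 1 + + m) * b)
           (sym (F≡Q^ (2 ℕ.+ m) k)) (sym (↑₂-cong-row m (↑₂-cong-row m (F≡Q^ m)) k)))
    (cong₂ (λ a b → + 2 * (+ 3 + + 2 * + m) * a + + 4 * (+ 1 + + m) * b)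
           (sym (↑₂-cong-row (1 ℕ.+ m) (F≡Q^ (1 ℕ.+ m)) k)) (sym (F≡Q^ m k)))
    (Q^-diagonal-recurrence m k)

Ppoly : Polynomial
Ppoly = (+ 1 , 0 , 0) ∷ (-[1+ 3 ] , 1 , 1) ∷ (+ 4 , 2 , 2) ∷ (-[1+ 3 ] , 2 , 0) ∷ []

P≐⟦Ppoly⟧ : P ≐ ⟦ Ppoly ⟧
P≐⟦Ppoly⟧ zero                zero                = refl
P≐⟦Ppoly⟧ zero                (suc k)             = refl
P≐⟦Ppoly⟧ (suc zero)          zero                = refl
P≐⟦Ppoly⟧ (suc zero)          (suc zero)          = refl
P≐⟦Ppoly⟧ (suc zero)          (suc (suc k))       = refl
P≐⟦Ppoly⟧ (suc (suc zero))    zero                = refl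
P≐⟦Ppoly⟧ (suc (suc zero))    (suc zero)          = refl
P≐⟦Ppoly⟧ (suc (suc zero))    (suc (suc zero))    = refl
P≐⟦Ppoly⟧ (suc (suc zero))    (suc (suc (suc k))) = refl
P≐⟦Ppoly⟧ (suc (suc (suc n))) zero                = refl
P≐⟦Ppoly⟧ (suc (suc (suc n))) (suc zero)          = refl
P≐⟦Ppoly⟧ (suc (suc (suc n))) (suc (suc zero))    = refl
P≐⟦Ppoly⟧ (suc (suc (suc n))) (suc (suc (suc k))) = refl

-- The differential equation

2θF : Series
2θF = θ F ⊕ θ F

↑₂-θ⊕θ : ∀ G → ↑₂ (θ G ⊕ θ G) ≐ θ (↑₂ G) ⊕ θ (↑₂ G)
↑₂-θ⊕θ G n k = trans (↑₂-⊕ (θ G) (θ G) n k) (sym (cong₂ _+_ (θ-↑₂ G n k) (θ-↑₂ G n k)))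

differential-equation-coefficient : ∀ m f₂ f₁ f₀′ f₀ →
  (+ 2 + m) * f₂ + + 4 * (+ 1 + m) * f₀′ ≡ + 2 * (+ 3 + + 2 * m) * f₁ + + 4 * (+ 1 + m) * f₀ →
  (+ 1 * ((+ 2 + m) * f₂ + (+ 2 + m) * f₂) + (-[1+ 3 ] * ((+ 1 + m) * f₁ + (+ 1 + m) * f₁)
     + (+ 4 * (m * f₀′ + m * f₀′) + (-[1+ 3 ] * (m * f₀ + m * f₀) + 0ℤ))))
  + (+ 0 * f₂ + (-[1+ 3 ] * f₁ + (+ 8 * f₀′ + (-[1+ 7 ] * f₀ + 0ℤ))))
  ≡ 0ℤ
differential-equation-coefficient m f₂ f₁ f₀′ f₀ h = begin
  _                     ≡⟨ twice m f₂ f₁ f₀′ f₀ ⟩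
  + 2 * (L - R)         ≡⟨ cong (λ a → + 2 * (a - R)) h ⟩
  + 2 * (R - R)         ≡⟨ cancel R ⟩
  0ℤ                    ∎
  where
  open ≡-Reasoning
  L = (+ 2 + m) * f₂ + + 4 * (+ 1 + m) * f₀′
  R = + 2 * (+ 3 + + 2 * m) * f₁ + + 4 * (+ 1 + m) * f₀
  twice : ∀ m f₂ f₁ f₀′ f₀ →
    (+ 1 * ((+ 2 + m) * f₂ + (+ 2 + m) * f₂) + (-[1+ 3 ] * ((+ 1 + m) * f₁ + (+ 1 + m) * f₁)
       + (+ 4 * (m * f₀′ + m * f₀′) + (-[1+ 3 ] * (m * f₀ + m * f₀) + 0ℤ))))
    + (+ 0 * f₂ + (-[1+ 3 ] * f₁ + (+ 8 * f₀′ + (-[1+ 7 ] * f₀ + 0ℤ))))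
    ≡ + 2 * (((+ 2 + m) * f₂ + + 4 * (+ 1 + m) * f₀′) - (+ 2 * (+ 3 + + 2 * m) * f₁ + + 4 * (+ 1 + m) * f₀))
  twice = solve-∀
  cancel : ∀ x → + 2 * (x - x) ≡ 0ℤ
  cancel = solve-∀

differential-equation : Ppoly *ₚ 2θF ⊕ ∂ Ppoly *ₚ F ≐ 0ₛ
differential-equation zero          k             = refl
differential-equation (suc zero)    zero          = refl
differential-equation (suc zero)    (suc zero)    = refl
differential-equation (suc zero)    (suc (suc k)) = refl
differential-equation (suc (suc m)) k             =
  trans (cong₂ (λ a b → (+ 1 * 2θF (2 ℕ.+ m) k + (-[1+ 3 ] * a + (+ 4 * b + (-[1+ 3 ] * 2θF m k + 0ℤ))))
                        + (∂ Ppoly *ₚ F) (2 ℕ.+ m) k)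
               (↑₂-θ⊕θ F (1 ℕ.+ m) k)
               (trans (↑₂-cong (↑₂-θ⊕θ F) m k) (↑₂-θ⊕θ (↑₂ F) m k)))
        (differential-equation-coefficient (+ m) (F (2 ℕ.+ m) k) (↑₂ F (1 ℕ.+ m) k) (↑₂ (↑₂ F) m k) (F m k)
                                           (F-recurrence m k))

θ-F² : θ (F ⊛ F) ≐ F ⊛ 2θF
θ-F² = begin
  θ (F ⊛ F)              ≈⟨ θ-⊛ F F ⟩
  θ F ⊛ F ⊕ F ⊛ θ F      ≈⟨ ⊕-cong (⊛-comm (θ F) F) (λ _ _ → refl) ⟩
  F ⊛ θ F ⊕ F ⊛ θ F      ≈⟨ ⊛-⊕ F (θ F) (θ F) ⟨
  F ⊛ 2θF                ∎
  where open ≐-Reasoning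

θ-F²P : θ ((F ⊛ F) ⊛ P) ≐ 0ₛ
θ-F²P = begin
  θ ((F ⊛ F) ⊛ P)
    ≈⟨ θ-⊛ (F ⊛ F) P ⟩
  θ (F ⊛ F) ⊛ P ⊕ (F ⊛ F) ⊛ θ P
    ≈⟨ ⊕-cong (⊛-congʳ P θ-F²) (⊛-congˡ (F ⊛ F) θP) ⟩
  (F ⊛ 2θF) ⊛ P ⊕ (F ⊛ F) ⊛ ⟦ ∂ Ppoly ⟧
    ≈⟨ ⊕-cong (⊛-congˡ (F ⊛ 2θF) P≐⟦Ppoly⟧) (λ _ _ → refl) ⟩
  (F ⊛ 2θF) ⊛ ⟦ Ppoly ⟧ ⊕ (F ⊛ F) ⊛ ⟦ ∂ Ppoly ⟧
    ≈⟨ ⊕-cong (⊛-assoc-⟦⟧ F 2θF Ppoly) (⊛-assoc-⟦⟧ F F (∂ Ppoly)) ⟩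
  F ⊛ (2θF ⊛ ⟦ Ppoly ⟧) ⊕ F ⊛ (F ⊛ ⟦ ∂ Ppoly ⟧)
    ≈⟨ ⊛-⊕ F (2θF ⊛ ⟦ Ppoly ⟧) (F ⊛ ⟦ ∂ Ppoly ⟧) ⟨
  F ⊛ (2θF ⊛ ⟦ Ppoly ⟧ ⊕ F ⊛ ⟦ ∂ Ppoly ⟧)
    ≈⟨ ⊛-congˡ F (⊕-cong (⊛-⟦⟧ 2θF Ppoly) (⊛-⟦⟧ F (∂ Ppoly))) ⟩
  F ⊛ (Ppoly *ₚ 2θF ⊕ ∂ Ppoly *ₚ F)
    ≈⟨ ⊛-congˡ F differential-equation ⟩
  F ⊛ 0ₛ
    ≈⟨ ⊛-0ₛ F ⟩
  0ₛ ∎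
  where
  open ≐-Reasoning
  θP : θ P ≐ ⟦ ∂ Ppoly ⟧
  θP n k = trans (θ-cong P≐⟦Ppoly⟧ n k) (θ-⟦⟧ Ppoly n k)

F-zero : ∀ k → F 0 k ≡ one 0 k
F-zero zero    = refl
F-zero (suc k) = refl

F²P-zero : ∀ k → ((F ⊛ F) ⊛ P) 0 k ≡ one 0 k
F²P-zero k = begin
  ((F ⊛ F) ⊛ P) 0 k                                      ≡⟨ ⊛-congˡ (F ⊛ F) P≐⟦Ppoly⟧ 0 k ⟩
  ((F ⊛ F) ⊛ ⟦ Ppoly ⟧) 0 k                              ≡⟨ ⊛-⟦⟧ (F ⊛ F) Ppoly 0 k ⟩
  + 1 * (F ⊛ F) 0 k + 0ℤ                                 ≡⟨ +-identityʳ _ ⟩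
  + 1 * (F ⊛ F) 0 k                                      ≡⟨ ℤₚ.*-identityˡ _ ⟩
  sumTo k (λ j → F 0 j * F 0 (k ∸ j))                    ≡⟨ sumTo-cong k (λ j → cong (F 0 j *_) (F-zero (k ∸ j))) ⟩
  (F ⊛ one) 0 k                                          ≡⟨ ⊛-one F 0 k ⟩
  F 0 k                                                  ≡⟨ F-zero k ⟩
  one 0 k                                                ∎
  where open ≡-Reasoning

theorem3p1 : ((k : ℕ) → F 0 k ≡ one 0 k)
    × ((n k : ℕ) → ((F ⊛ F) ⊛ P) n k ≡ one n k)
theorem3p1 = F-zero , F²P≡one
  where
  cancel-suc : ∀ n h → + suc n * h ≡ 0ℤ → h ≡ 0ℤ
  cancel-suc n h p with i*j≡0⇒i≡0∨j≡0 (+ suc n) p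
  ... | inj₂ h≡0 = h≡0
  F²P≡one : (n k : ℕ) → ((F ⊛ F) ⊛ P) n k ≡ one n k
  F²P≡one zero    k = F²P-zero k
  F²P≡one (suc n) k = cancel-suc n (((F ⊛ F) ⊛ P) (suc n) k) (θ-F²P (suc n) k)
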